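{- Let $M$ be an invertible form. (1) If $N$ is an invertible form, then $M\{N/x\}$ is an invertible form and $\lfloor M\rfloor\{\lfloor N\rfloor/x\}=\lfloor M\{N/x\}\rfloor$. (2) If $M\hookrightarrow N$ by one step of the rule $\mathbf{app}_{s_1,s_2}AB(\mathbf{abs}_{s_1,s_2}A'B'P)Q\hookrightarrow PQ$, then $N$ is an invertible form and $\lfloor M\rfloor\hookrightarrow^*\lfloor N\rfloor$ in the EPTS. (3) If $M\hookrightarrow N$ by one step of Dedukti $\beta$ or of a rule $\mathbf{El}_{s_2}\mathbf u_{s_1}\hookrightarrow\mathbf U_{s_1}$, then $N$ is an invertible form and $\lfloor M\rfloor=\lfloor N\rfloor$. (4) If $M\hookrightarrow^*_{\beta\mathscr R_{EPTS}}N$, then $N$ is an invertible form and $\lfloor M\rfloor\hookrightarrow^*\lfloor N\rfloor$ in the EPTS.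
   Context: Functional PTS specification $(\mathcal S,\mathcal A,\mathcal R)$; EPTS terms $x\mid s\mid\Pi_{s_1,s_2}(A,x.B)\mid\lambda_{s_1,s_2}(A,x.B,x.M)\mid@_{s_1,s_2}(A,x.B,M,N)$ with EPTS reduction the context closure of $@_{s_1,s_2}(A,x.B,\lambda_{s_1,s_2}(A',x.B',x.M),N)\hookrightarrow M\{N/x\}$. Dedukti rewrite system $\mathscr R_{EPTS}$: rules $\mathbf{El}_{s_2}\mathbf u_{s_1}\hookrightarrow\mathbf U_{s_1}$ for $(s_1,s_2)\in\mathcal A$ and $\mathbf{app}_{s_1,s_2}AB(\mathbf{abs}_{s_1,s_2}A'B'M)N\hookrightarrow MN$ for $(s_1,s_2,s_3)\in\mathcal R$, closed under contexts and substitutions; $\hookrightarrow_{\beta\mathscr R_{EPTS}}$ adds Dedukti $\beta$. Invertible forms: Dedukti terms generated by $M,N,A,B::=x\mid\mathbf u_s\mid\mathbf{abs}_{s_1,s_2}A(\lambda x:T_1.B)(\lambda x:T_2.M)\mid(\lambda x:T.M)N\mid\mathbf{Prod}_{s_1,s_2}A(\lambda x:T_1.B)\mid\mathbf{app}_{s_1,s_2}A(\lambda x:T_1.B)MN$ with $T,T_1,T_2$ arbitrary. Inverse translation: $\lfloor x\rfloor=x$, $\lfloor\mathbf u_s\rfloor=s$, $\lfloor(\lambda x:T.M)N\rfloor=\lfloor M\rfloor\{\lfloor N\rfloor/x\}$, $\lfloor\mathbf{Prod}_{s_1,s_2}A(\lambda x:T.B)\rfloor=\Pi_{s_1,s_2}(\lfloor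 A\rfloor,x.\lfloor B\rfloor)$, $\lfloor\mathbf{abs}_{s_1,s_2}A(\lambda x:T.B)(\lambda x:T'.M)\rfloor=\lambda_{s_1,s_2}(\lfloor A\rfloor,x.\lfloor B\rfloor,x.\lfloor M\rfloor)$, $\lfloor\mathbf{app}_{s_1,s_2}A(\lambda x:T.B)MN\rfloor=@_{s_1,s_2}(\lfloor A\rfloor,x.\lfloor B\rfloor,\lfloor M\rfloor,\lfloor N\rfloor)$. -}

module Defs where

open import Data.Nat using (ℕ; zero; suc)
open import Data.Fin using (Fin; zero; suc)
open import Relation.Binary.PropositionalEquality using (_≡_)
open import Relation.Binary.Construct.Closure.ReflexiveTransitive using (Star)

record PTSSpec : Set₁ where
  field
    Sort : Set
    Ax   : Sort → Sort → Set
    Rl   : Sort → Sort → Sort → Set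
    Ax-functional : ∀ {s₁ s₂ s₂'} → Ax s₁ s₂ → Ax s₁ s₂' → s₂ ≡ s₂'
    Rl-functional : ∀ {s₁ s₂ s₃ s₃'} → Rl s₁ s₂ s₃ → Rl s₁ s₂ s₃' → s₃ ≡ s₃'

ext : ∀ {m n} → (Fin m → Fin n) → Fin (suc m) → Fin (suc n)
ext ρ zero    = zero
ext ρ (suc i) = suc (ρ i)

module Syntax (𝒮 : PTSSpec) where
  open PTSSpec 𝒮

  data ETerm (n : ℕ) : Set where
    var : Fin n → ETerm n
    srt : Sort → ETerm n
    piₑ  : Sort → Sort → ETerm n → ETerm (suc n) → ETerm n
    lamₑ  : Sort → Sort → ETerm n → ETerm (suc n) → ETerm (suc n) → ETerm n
    appₑ  : Sort → Sort → ETerm n → ETerm (suc n) → ETerm n → ETerm n → ETerm n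

  renE : ∀ {m n} → (Fin m → Fin n) → ETerm m → ETerm n
  renE ρ (var x) = var (ρ x)
  renE ρ (srt s) = srt s
  renE ρ (piₑ s₁ s₂ A B) = piₑ s₁ s₂ (renE ρ A) (renE (ext ρ) B)
  renE ρ (lamₑ s₁ s₂ A B M) = lamₑ s₁ s₂ (renE ρ A) (renE (ext ρ) B) (renE (ext ρ) M)
  renE ρ (appₑ s₁ s₂ A B M N) = appₑ s₁ s₂ (renE ρ A) (renE (ext ρ) B) (renE ρ M) (renE ρ N)

  extsE : ∀ {m n} → (Fin m → ETerm n) → Fin (suc m) → ETerm (suc n)
  extsE σ zero    = var zero
  extsE σ (suc i) = renE suc (σ i)

  subE : ∀ {m n} → (Fin m → ETerm n) → ETerm m → ETerm n
  subE σ (var x) = σ x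
  subE σ (srt s) = srt s
  subE σ (piₑ s₁ s₂ A B) = piₑ s₁ s₂ (subE σ A) (subE (extsE σ) B)
  subE σ (lamₑ s₁ s₂ A B M) = lamₑ s₁ s₂ (subE σ A) (subE (extsE σ) B) (subE (extsE σ) M)
  subE σ (appₑ s₁ s₂ A B M N) = appₑ s₁ s₂ (subE σ A) (subE (extsE σ) B) (subE σ M) (subE σ N)

  _[_]ᴱ : ∀ {n} → ETerm (suc n) → ETerm n → ETerm n
  M [ N ]ᴱ = subE σ M
    where
    σ : _ → _
    σ zero    = N
    σ (suc i) = var i

  data _⟶ᴱ_ : ∀ {n} → ETerm n → ETerm n → Set where
    beta : ∀ {n s₁ s₂} {A A' : ETerm n} {B B' M : ETerm (suc n)} {N : ETerm n} →
           appₑ s₁ s₂ A B (lamₑ s₁ s₂ A' B' M) N ⟶ᴱ (M [ N ]ᴱ)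
    Π₁ : ∀ {n s₁ s₂} {A A' : ETerm n} {B} → A ⟶ᴱ A' → piₑ s₁ s₂ A B ⟶ᴱ piₑ s₁ s₂ A' B
    Π₂ : ∀ {n s₁ s₂} {A : ETerm n} {B B'} → B ⟶ᴱ B' → piₑ s₁ s₂ A B ⟶ᴱ piₑ s₁ s₂ A B'
    lam₁ : ∀ {n s₁ s₂} {A A' : ETerm n} {B M} → A ⟶ᴱ A' → lamₑ s₁ s₂ A B M ⟶ᴱ lamₑ s₁ s₂ A' B M
    lam₂ : ∀ {n s₁ s₂} {A : ETerm n} {B B' M} → B ⟶ᴱ B' → lamₑ s₁ s₂ A B M ⟶ᴱ lamₑ s₁ s₂ A B' M
    lam₃ : ∀ {n s₁ s₂} {A : ETerm n} {B M M'} → M ⟶ᴱ M' → lamₑ s₁ s₂ A B M ⟶ᴱ lamₑ s₁ s₂ A B M'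
    app₁ : ∀ {n s₁ s₂} {A A' : ETerm n} {B M N} → A ⟶ᴱ A' → appₑ s₁ s₂ A B M N ⟶ᴱ appₑ s₁ s₂ A' B M N
    app₂ : ∀ {n s₁ s₂} {A : ETerm n} {B B' M N} → B ⟶ᴱ B' → appₑ s₁ s₂ A B M N ⟶ᴱ appₑ s₁ s₂ A B' M N
    app₃ : ∀ {n s₁ s₂} {A : ETerm n} {B M M' N} → M ⟶ᴱ M' → appₑ s₁ s₂ A B M N ⟶ᴱ appₑ s₁ s₂ A B M' N
    app₄ : ∀ {n s₁ s₂} {A : ETerm n} {B M N N'} → N ⟶ᴱ N' → appₑ s₁ s₂ A B M N ⟶ᴱ appₑ s₁ s₂ A B M N'

  _⟶ᴱ*_ : ∀ {n} → ETerm n → ETerm n → Set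
  _⟶ᴱ*_ {n} = Star (_⟶ᴱ_ {n})

  -- Dedukti (λΠ-modulo) terms over the EPTS signature
  data Const : Set where
    u U El   : Sort → Const
    Prod abs app : Sort → Sort → Const

  data DTerm (n : ℕ) : Set where
    var  : Fin n → DTerm n
    cst  : Const → DTerm n
    TYPE : DTerm n
    KIND : DTerm n
    Πd   : DTerm n → DTerm (suc n) → DTerm n
    lamd    : DTerm n → DTerm (suc n) → DTerm n
    _·_  : DTerm n → DTerm n → DTerm n
  infixl 7 _·_

  renD : ∀ {m n} → (Fin m → Fin n) → DTerm m → DTerm n
  renD ρ (var x) = var (ρ x)
  renD ρ (cst c) = cst c
  renD ρ TYPE = TYPE
  renD ρ KIND = KIND
  renD ρ (Πd A B) = Πd (renD ρ A) (renD (ext ρ) B)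
  renD ρ (lamd T M) = lamd (renD ρ T) (renD (ext ρ) M)
  renD ρ (M · N) = renD ρ M · renD ρ N

  extsD : ∀ {m n} → (Fin m → DTerm n) → Fin (suc m) → DTerm (suc n)
  extsD σ zero    = var zero
  extsD σ (suc i) = renD suc (σ i)

  subD : ∀ {m n} → (Fin m → DTerm n) → DTerm m → DTerm n
  subD σ (var x) = σ x
  subD σ (cst c) = cst c
  subD σ TYPE = TYPE
  subD σ KIND = KIND
  subD σ (Πd A B) = Πd (subD σ A) (subD (extsD σ) B)
  subD σ (lamd T M) = lamd (subD σ T) (subD (extsD σ) M)
  subD σ (M · N) = subD σ M · subD σ N

  _[_] : ∀ {n} → DTerm (suc n) → DTerm n → DTerm n
  M [ N ] = subD σ M
    where
    σ : _ → _
    σ zero    = N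
    σ (suc i) = var i

  data RuleKind : Set where
    βK ElK appK : RuleKind

  data Top : RuleKind → ∀ {n} → DTerm n → DTerm n → Set where
    βr  : ∀ {n} {T : DTerm n} {M N} → Top βK (lamd T M · N) (M [ N ])
    El-u : ∀ {n s₁ s₂} → Ax s₁ s₂ →
           Top ElK {n} (cst (El s₂) · cst (u s₁)) (cst (U s₁))
    app-abs : ∀ {n s₁ s₂ s₃} {A B A' B' M N : DTerm n} → Rl s₁ s₂ s₃ →
           Top appK (cst (app s₁ s₂) · A · B · (cst (abs s₁ s₂) · A' · B' · M) · N) (M · N)

  -- context closure (closure under substitution is built into Top,
  -- whose metavariables range over arbitrary terms)
  data Step (k : RuleKind) : ∀ {n} → DTerm n → DTerm n → Set where
    top : ∀ {n} {M N : DTerm n} → Top k M N → Step k M N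
    Π₁  : ∀ {n} {A A' : DTerm n} {B} → Step k A A' → Step k (Πd A B) (Πd A' B)
    Π₂  : ∀ {n} {A : DTerm n} {B B'} → Step k B B' → Step k (Πd A B) (Πd A B')
    lamd₁  : ∀ {n} {T T' : DTerm n} {M} → Step k T T' → Step k (lamd T M) (lamd T' M)
    lamd₂  : ∀ {n} {T : DTerm n} {M M'} → Step k M M' → Step k (lamd T M) (lamd T M')
    ·₁  : ∀ {n} {M M' N : DTerm n} → Step k M M' → Step k (M · N) (M' · N)
    ·₂  : ∀ {n} {M N N' : DTerm n} → Step k N N' → Step k (M · N) (M · N')

  data _⟶_ {n : ℕ} (M N : DTerm n) : Set where
    step : (k : RuleKind) → Step k M N → M ⟶ N

  _⟶*_ : ∀ {n} → DTerm n → DTerm n → Set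
  _⟶*_ {n} = Star (_⟶_ {n})

  data Inv {n : ℕ} : DTerm n → Set where
    ivar  : (x : Fin n) → Inv (var x)
    iu    : (s : Sort) → Inv (cst (u s))
    iabs  : ∀ s₁ s₂ {A T₁ T₂ : DTerm n} {B M : DTerm (suc n)} →
            Inv A → Inv B → Inv M →
            Inv (cst (abs s₁ s₂) · A · lamd T₁ B · lamd T₂ M)
    iβ    : ∀ {T : DTerm n} {M : DTerm (suc n)} {N : DTerm n} →
            Inv M → Inv N → Inv (lamd T M · N)
    iProd : ∀ s₁ s₂ {A T₁ : DTerm n} {B : DTerm (suc n)} →
            Inv A → Inv B → Inv (cst (Prod s₁ s₂) · A · lamd T₁ B)
    iapp  : ∀ s₁ s₂ {A T₁ M N : DTerm n} {B : DTerm (suc n)} →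
            Inv A → Inv B → Inv M → Inv N →
            Inv (cst (app s₁ s₂) · A · lamd T₁ B · M · N)

  ⌊_⌋ : ∀ {n} {M : DTerm n} → Inv M → ETerm n
  ⌊ ivar x ⌋ = var x
  ⌊ iu s ⌋ = srt s
  ⌊ iabs s₁ s₂ a b m ⌋ = lamₑ s₁ s₂ ⌊ a ⌋ ⌊ b ⌋ ⌊ m ⌋
  ⌊ iβ m n ⌋ = ⌊ m ⌋ [ ⌊ n ⌋ ]ᴱ
  ⌊ iProd s₁ s₂ a b ⌋ = piₑ s₁ s₂ ⌊ a ⌋ ⌊ b ⌋
  ⌊ iapp s₁ s₂ a b m n ⌋ = appₑ s₁ s₂ ⌊ a ⌋ ⌊ b ⌋ ⌊ m ⌋ ⌊ n ⌋

-- The inverse translation forgets the annotation T of every Dedukti abstraction λx:T.M, so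
-- reductions inside annotations are invisible to it; in particular El never occurs in an
-- invertible form, so El/u-redexes can only sit inside annotations. A β-redex (λx:T.M)N is
-- already read back as ⌊M⌋{⌊N⌋/x}, which by (1) is the read-back of its contractum, and an
-- app/abs-redex is read back as an EPTS β-redex whose contractum is the read-back of
-- (λx:T.P)Q. Steps below the root are carried along because both equality and EPTS
-- multi-step reduction are congruences that are closed under substitution.
module Submission where

open import Defs
open import Data.Nat using (suc)
open import Data.Fin using (Fin; zero; suc)
open import Data.Product using (_×_; _,_; Σ)
open import Data.Sum using (_⊎_; inj₁; inj₂)
open import Data.Vec.Functional using (_∷_)
open import Function using (_∘_; id)
open import Relation.Binary.PropositionalEquality
  using (_≡_; refl; sym; trans; cong; cong₂; subst; subst₂; _≗_; module ≡-Reasoning)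
open import Relation.Binary.Construct.Closure.ReflexiveTransitive
  using (ε; _◅_; _◅◅_; gmap)

cong₃ : ∀ {A B C D : Set} (f : A → B → C → D) {a a' b b' c c'} →
        a ≡ a' → b ≡ b' → c ≡ c' → f a b c ≡ f a' b' c'
cong₃ f refl refl refl = refl

cong₄ : ∀ {A B C D E : Set} (f : A → B → C → D → E) {a a' b b' c c' d d'} →
        a ≡ a' → b ≡ b' → c ≡ c' → d ≡ d' → f a b c d ≡ f a' b' c' d'
cong₄ f refl refl refl refl = refl

module InverseTranslation (𝒮 : PTSSpec) where
  open Syntax 𝒮

  ext-∘ : ∀ {l m n} {ρ : Fin m → Fin n} {ρ' : Fin l → Fin m} {ρ'' : Fin l → Fin n} →
          ρ ∘ ρ' ≗ ρ'' → ext ρ ∘ ext ρ' ≗ ext ρ''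
  ext-∘ h zero    = refl
  ext-∘ h (suc x) = cong suc (h x)

  renE-∘ : ∀ {l m n} {ρ : Fin m → Fin n} {ρ' : Fin l → Fin m} {ρ'' : Fin l → Fin n} →
           ρ ∘ ρ' ≗ ρ'' → renE ρ ∘ renE ρ' ≗ renE ρ''
  renE-∘ h (var x)              = cong var (h x)
  renE-∘ h (srt s)              = refl
  renE-∘ h (piₑ s₁ s₂ A B)      = cong₂ (piₑ s₁ s₂) (renE-∘ h A) (renE-∘ (ext-∘ h) B)
  renE-∘ h (lamₑ s₁ s₂ A B M)   =
    cong₃ (lamₑ s₁ s₂) (renE-∘ h A) (renE-∘ (ext-∘ h) B) (renE-∘ (ext-∘ h) M)
  renE-∘ h (appₑ s₁ s₂ A B M N) =
    cong₄ (appₑ s₁ s₂) (renE-∘ h A) (renE-∘ (ext-∘ h) B) (renE-∘ h M) (renE-∘ h N)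

  extsE-ext : ∀ {l m n} {σ : Fin m → ETerm n} {ρ : Fin l → Fin m} {τ : Fin l → ETerm n} →
              σ ∘ ρ ≗ τ → extsE σ ∘ ext ρ ≗ extsE τ
  extsE-ext h zero    = refl
  extsE-ext h (suc x) = cong (renE suc) (h x)

  subE-renE : ∀ {l m n} {σ : Fin m → ETerm n} {ρ : Fin l → Fin m} {τ : Fin l → ETerm n} →
              σ ∘ ρ ≗ τ → subE σ ∘ renE ρ ≗ subE τ
  subE-renE h (var x)              = h x
  subE-renE h (srt s)              = refl
  subE-renE h (piₑ s₁ s₂ A B)      = cong₂ (piₑ s₁ s₂) (subE-renE h A) (subE-renE (extsE-ext h) B)
  subE-renE h (lamₑ s₁ s₂ A B M)   =
    cong₃ (lamₑ s₁ s₂) (subE-renE h A) (subE-renE (extsE-ext h) B) (subE-renE (extsE-ext h) M)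
  subE-renE h (appₑ s₁ s₂ A B M N) =
    cong₄ (appₑ s₁ s₂) (subE-renE h A) (subE-renE (extsE-ext h) B) (subE-renE h M) (subE-renE h N)

  renE-extsE : ∀ {l m n} {ρ : Fin m → Fin n} {σ : Fin l → ETerm m} {τ : Fin l → ETerm n} →
               renE ρ ∘ σ ≗ τ → renE (ext ρ) ∘ extsE σ ≗ extsE τ
  renE-extsE h zero = refl
  renE-extsE {ρ = ρ} {σ} {τ} h (suc x) = begin
    renE (ext ρ) (renE suc (σ x))  ≡⟨ renE-∘ (λ _ → refl) (σ x) ⟩
    renE (suc ∘ ρ) (σ x)           ≡⟨ renE-∘ (λ _ → refl) (σ x) ⟨
    renE suc (renE ρ (σ x))        ≡⟨ cong (renE suc) (h x) ⟩
    extsE τ (suc x)                ∎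
    where open ≡-Reasoning

  renE-subE : ∀ {l m n} {ρ : Fin m → Fin n} {σ : Fin l → ETerm m} {τ : Fin l → ETerm n} →
              renE ρ ∘ σ ≗ τ → renE ρ ∘ subE σ ≗ subE τ
  renE-subE h (var x)              = h x
  renE-subE h (srt s)              = refl
  renE-subE h (piₑ s₁ s₂ A B)      = cong₂ (piₑ s₁ s₂) (renE-subE h A) (renE-subE (renE-extsE h) B)
  renE-subE h (lamₑ s₁ s₂ A B M)   =
    cong₃ (lamₑ s₁ s₂) (renE-subE h A) (renE-subE (renE-extsE h) B) (renE-subE (renE-extsE h) M)
  renE-subE h (appₑ s₁ s₂ A B M N) =
    cong₄ (appₑ s₁ s₂) (renE-subE h A) (renE-subE (renE-extsE h) B) (renE-subE h M) (renE-subE h N)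

  extsE-extsE : ∀ {l m n} {σ : Fin m → ETerm n} {τ : Fin l → ETerm m} {υ : Fin l → ETerm n} →
                subE σ ∘ τ ≗ υ → subE (extsE σ) ∘ extsE τ ≗ extsE υ
  extsE-extsE h zero = refl
  extsE-extsE {σ = σ} {τ} {υ} h (suc x) = begin
    subE (extsE σ) (renE suc (τ x))  ≡⟨ subE-renE (λ _ → refl) (τ x) ⟩
    subE (renE suc ∘ σ) (τ x)        ≡⟨ renE-subE (λ _ → refl) (τ x) ⟨
    renE suc (subE σ (τ x))          ≡⟨ cong (renE suc) (h x) ⟩
    extsE υ (suc x)                  ∎
    where open ≡-Reasoning

  subE-subE : ∀ {l m n} {σ : Fin m → ETerm n} {τ : Fin l → ETerm m} {υ : Fin l → ETerm n} →
              subE σ ∘ τ ≗ υ → subE σ ∘ subE τ ≗ subE υ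
  subE-subE h (var x)              = h x
  subE-subE h (srt s)              = refl
  subE-subE h (piₑ s₁ s₂ A B)      = cong₂ (piₑ s₁ s₂) (subE-subE h A) (subE-subE (extsE-extsE h) B)
  subE-subE h (lamₑ s₁ s₂ A B M)   =
    cong₃ (lamₑ s₁ s₂) (subE-subE h A) (subE-subE (extsE-extsE h) B) (subE-subE (extsE-extsE h) M)
  subE-subE h (appₑ s₁ s₂ A B M N) =
    cong₄ (appₑ s₁ s₂) (subE-subE h A) (subE-subE (extsE-extsE h) B) (subE-subE h M) (subE-subE h N)

  extsE-var : ∀ {m} {σ : Fin m → ETerm m} → σ ≗ var → extsE σ ≗ var
  extsE-var h zero    = refl
  extsE-var h (suc x) = cong (renE suc) (h x)

  subE-var : ∀ {m} {σ : Fin m → ETerm m} → σ ≗ var → subE σ ≗ id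
  subE-var h (var x)              = h x
  subE-var h (srt s)              = refl
  subE-var h (piₑ s₁ s₂ A B)      = cong₂ (piₑ s₁ s₂) (subE-var h A) (subE-var (extsE-var h) B)
  subE-var h (lamₑ s₁ s₂ A B M)   =
    cong₃ (lamₑ s₁ s₂) (subE-var h A) (subE-var (extsE-var h) B) (subE-var (extsE-var h) M)
  subE-var h (appₑ s₁ s₂ A B M N) =
    cong₄ (appₑ s₁ s₂) (subE-var h A) (subE-var (extsE-var h) B) (subE-var h M) (subE-var h N)

  extsE-renaming : ∀ {m n} {ρ : Fin m → Fin n} {σ : Fin m → ETerm n} →
                   var ∘ ρ ≗ σ → var ∘ ext ρ ≗ extsE σ
  extsE-renaming h zero    = refl
  extsE-renaming h (suc x) = cong (renE suc) (h x)

  renE-as-subE : ∀ {m n} {ρ : Fin m → Fin n} {σ : Fin m → ETerm n} →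
                 var ∘ ρ ≗ σ → renE ρ ≗ subE σ
  renE-as-subE h (var x)              = h x
  renE-as-subE h (srt s)              = refl
  renE-as-subE h (piₑ s₁ s₂ A B)      =
    cong₂ (piₑ s₁ s₂) (renE-as-subE h A) (renE-as-subE (extsE-renaming h) B)
  renE-as-subE h (lamₑ s₁ s₂ A B M)   =
    cong₃ (lamₑ s₁ s₂) (renE-as-subE h A) (renE-as-subE (extsE-renaming h) B)
      (renE-as-subE (extsE-renaming h) M)
  renE-as-subE h (appₑ s₁ s₂ A B M N) =
    cong₄ (appₑ s₁ s₂) (renE-as-subE h A) (renE-as-subE (extsE-renaming h) B)
      (renE-as-subE h M) (renE-as-subE h N)

  subE-[]ᴱ : ∀ {m n} (σ : Fin m → ETerm n) (M : ETerm (suc m)) (N : ETerm m) →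
             subE σ (M [ N ]ᴱ) ≡ subE (extsE σ) M [ subE σ N ]ᴱ
  subE-[]ᴱ σ M N = begin
    subE σ (M [ N ]ᴱ)               ≡⟨ subE-subE (λ { zero → refl ; (suc _) → refl }) M ⟩
    subE (subE σ N ∷ σ) M           ≡⟨ subE-subE (λ { zero → refl ; (suc x) → [extsE]-suc x }) M ⟨
    subE (extsE σ) M [ subE σ N ]ᴱ  ∎
    where
    open ≡-Reasoning
    [extsE]-suc : ∀ x → renE suc (σ x) [ subE σ N ]ᴱ ≡ σ x
    [extsE]-suc x = trans (subE-renE (λ _ → refl) (σ x)) (subE-var (λ _ → refl) (σ x))

  renE-[]ᴱ : ∀ {m n} (ρ : Fin m → Fin n) (M : ETerm (suc m)) (N : ETerm m) →
             renE ρ (M [ N ]ᴱ) ≡ renE (ext ρ) M [ renE ρ N ]ᴱ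
  renE-[]ᴱ ρ M N = begin
    renE ρ (M [ N ]ᴱ)                            ≡⟨ renE-as-subE (λ _ → refl) (M [ N ]ᴱ) ⟩
    subE (var ∘ ρ) (M [ N ]ᴱ)                    ≡⟨ subE-[]ᴱ (var ∘ ρ) M N ⟩
    subE (extsE (var ∘ ρ)) M [ subE (var ∘ ρ) N ]ᴱ
      ≡⟨ cong₂ _[_]ᴱ (renE-as-subE (extsE-renaming (λ _ → refl)) M) (renE-as-subE (λ _ → refl) N) ⟨
    renE (ext ρ) M [ renE ρ N ]ᴱ                 ∎
    where open ≡-Reasoning

  subE-⟶ᴱ : ∀ {m n} (σ : Fin m → ETerm n) {M M' : ETerm m} → M ⟶ᴱ M' → subE σ M ⟶ᴱ subE σ M'
  subE-⟶ᴱ σ (beta {M = M} {N = N}) = subst (_⟶ᴱ_ _) (sym (subE-[]ᴱ σ M N)) beta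
  subE-⟶ᴱ σ (Π₁ s)   = Π₁ (subE-⟶ᴱ σ s)
  subE-⟶ᴱ σ (Π₂ s)   = Π₂ (subE-⟶ᴱ (extsE σ) s)
  subE-⟶ᴱ σ (lam₁ s) = lam₁ (subE-⟶ᴱ σ s)
  subE-⟶ᴱ σ (lam₂ s) = lam₂ (subE-⟶ᴱ (extsE σ) s)
  subE-⟶ᴱ σ (lam₃ s) = lam₃ (subE-⟶ᴱ (extsE σ) s)
  subE-⟶ᴱ σ (app₁ s) = app₁ (subE-⟶ᴱ σ s)
  subE-⟶ᴱ σ (app₂ s) = app₂ (subE-⟶ᴱ (extsE σ) s)
  subE-⟶ᴱ σ (app₃ s) = app₃ (subE-⟶ᴱ σ s)
  subE-⟶ᴱ σ (app₄ s) = app₄ (subE-⟶ᴱ σ s)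

  renE-⟶ᴱ : ∀ {m n} (ρ : Fin m → Fin n) {M M' : ETerm m} → M ⟶ᴱ M' → renE ρ M ⟶ᴱ renE ρ M'
  renE-⟶ᴱ ρ {M} {M'} s =
    subst₂ _⟶ᴱ_ (sym (renE-as-subE (λ _ → refl) M)) (sym (renE-as-subE (λ _ → refl) M'))
      (subE-⟶ᴱ (var ∘ ρ) s)

  piₑ-⟶ᴱ* : ∀ {n s₁ s₂} {A A' : ETerm n} {B B'} → A ⟶ᴱ* A' → B ⟶ᴱ* B' →
            piₑ s₁ s₂ A B ⟶ᴱ* piₑ s₁ s₂ A' B'
  piₑ-⟶ᴱ* {A' = A'} {B} a b = gmap (λ X → piₑ _ _ X B) Π₁ a ◅◅ gmap (piₑ _ _ A') Π₂ b

  lamₑ-⟶ᴱ* : ∀ {n s₁ s₂} {A A' : ETerm n} {B B' M M'} → A ⟶ᴱ* A' → B ⟶ᴱ* B' → M ⟶ᴱ* M' →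
             lamₑ s₁ s₂ A B M ⟶ᴱ* lamₑ s₁ s₂ A' B' M'
  lamₑ-⟶ᴱ* {A' = A'} {B} {B'} {M} a b m =
    gmap (λ X → lamₑ _ _ X B M) lam₁ a ◅◅
    gmap (λ X → lamₑ _ _ A' X M) lam₂ b ◅◅
    gmap (lamₑ _ _ A' B') lam₃ m

  appₑ-⟶ᴱ* : ∀ {n s₁ s₂} {A A' : ETerm n} {B B' M M' N N'} →
             A ⟶ᴱ* A' → B ⟶ᴱ* B' → M ⟶ᴱ* M' → N ⟶ᴱ* N' →
             appₑ s₁ s₂ A B M N ⟶ᴱ* appₑ s₁ s₂ A' B' M' N'
  appₑ-⟶ᴱ* {A' = A'} {B} {B'} {M} {M'} {N} a b m n =
    gmap (λ X → appₑ _ _ X B M N) app₁ a ◅◅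
    gmap (λ X → appₑ _ _ A' X M N) app₂ b ◅◅
    gmap (λ X → appₑ _ _ A' B' X N) app₃ m ◅◅
    gmap (appₑ _ _ A' B' M') app₄ n

  extsE-⟶ᴱ* : ∀ {m n} {σ τ : Fin m → ETerm n} →
              (∀ x → σ x ⟶ᴱ* τ x) → ∀ x → extsE σ x ⟶ᴱ* extsE τ x
  extsE-⟶ᴱ* h zero    = ε
  extsE-⟶ᴱ* h (suc x) = gmap (renE suc) (renE-⟶ᴱ suc) (h x)

  subE-⟶ᴱ* : ∀ {m n} {σ τ : Fin m → ETerm n} →
             (∀ x → σ x ⟶ᴱ* τ x) → ∀ M → subE σ M ⟶ᴱ* subE τ M
  subE-⟶ᴱ* h (var x)              = h x
  subE-⟶ᴱ* h (srt s)              = ε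
  subE-⟶ᴱ* h (piₑ s₁ s₂ A B)      = piₑ-⟶ᴱ* (subE-⟶ᴱ* h A) (subE-⟶ᴱ* (extsE-⟶ᴱ* h) B)
  subE-⟶ᴱ* h (lamₑ s₁ s₂ A B M)   =
    lamₑ-⟶ᴱ* (subE-⟶ᴱ* h A) (subE-⟶ᴱ* (extsE-⟶ᴱ* h) B) (subE-⟶ᴱ* (extsE-⟶ᴱ* h) M)
  subE-⟶ᴱ* h (appₑ s₁ s₂ A B M N) =
    appₑ-⟶ᴱ* (subE-⟶ᴱ* h A) (subE-⟶ᴱ* (extsE-⟶ᴱ* h) B) (subE-⟶ᴱ* h M) (subE-⟶ᴱ* h N)

  []ᴱ-⟶ᴱ* : ∀ {n} {M M' : ETerm (suc n)} {N N' : ETerm n} → M ⟶ᴱ* M' → N ⟶ᴱ* N' →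
            (M [ N ]ᴱ) ⟶ᴱ* (M' [ N' ]ᴱ)
  []ᴱ-⟶ᴱ* {M' = M'} {N} m n =
    gmap (_[ N ]ᴱ) (subE-⟶ᴱ _) m ◅◅ subE-⟶ᴱ* (λ { zero → n ; (suc x) → ε }) M'

  renD-Inv : ∀ {m n} (ρ : Fin m → Fin n) {M : DTerm m} → Inv M → Inv (renD ρ M)
  renD-Inv ρ (ivar x)             = ivar (ρ x)
  renD-Inv ρ (iu s)               = iu s
  renD-Inv ρ (iabs s₁ s₂ a b m)   = iabs s₁ s₂ (renD-Inv ρ a) (renD-Inv (ext ρ) b) (renD-Inv (ext ρ) m)
  renD-Inv ρ (iβ m n)             = iβ (renD-Inv (ext ρ) m) (renD-Inv ρ n)
  renD-Inv ρ (iProd s₁ s₂ a b)    = iProd s₁ s₂ (renD-Inv ρ a) (renD-Inv (ext ρ) b)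
  renD-Inv ρ (iapp s₁ s₂ a b m n) =
    iapp s₁ s₂ (renD-Inv ρ a) (renD-Inv (ext ρ) b) (renD-Inv ρ m) (renD-Inv ρ n)

  ⌊renD-Inv⌋ : ∀ {m n} (ρ : Fin m → Fin n) {M : DTerm m} (p : Inv M) →
               ⌊ renD-Inv ρ p ⌋ ≡ renE ρ ⌊ p ⌋
  ⌊renD-Inv⌋ ρ (ivar x)             = refl
  ⌊renD-Inv⌋ ρ (iu s)               = refl
  ⌊renD-Inv⌋ ρ (iabs s₁ s₂ a b m)   =
    cong₃ (lamₑ s₁ s₂) (⌊renD-Inv⌋ ρ a) (⌊renD-Inv⌋ (ext ρ) b) (⌊renD-Inv⌋ (ext ρ) m)
  ⌊renD-Inv⌋ ρ (iβ m n)             =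
    trans (cong₂ _[_]ᴱ (⌊renD-Inv⌋ (ext ρ) m) (⌊renD-Inv⌋ ρ n)) (sym (renE-[]ᴱ ρ ⌊ m ⌋ ⌊ n ⌋))
  ⌊renD-Inv⌋ ρ (iProd s₁ s₂ a b)    = cong₂ (piₑ s₁ s₂) (⌊renD-Inv⌋ ρ a) (⌊renD-Inv⌋ (ext ρ) b)
  ⌊renD-Inv⌋ ρ (iapp s₁ s₂ a b m n) =
    cong₄ (appₑ s₁ s₂) (⌊renD-Inv⌋ ρ a) (⌊renD-Inv⌋ (ext ρ) b) (⌊renD-Inv⌋ ρ m) (⌊renD-Inv⌋ ρ n)

  extsD-Inv : ∀ {m n} {σ : Fin m → DTerm n} → (∀ x → Inv (σ x)) → ∀ x → Inv (extsD σ x)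
  extsD-Inv ι zero    = ivar zero
  extsD-Inv ι (suc x) = renD-Inv suc (ι x)

  subD-Inv : ∀ {m n} {σ : Fin m → DTerm n} → (∀ x → Inv (σ x)) → {M : DTerm m} → Inv M → Inv (subD σ M)
  subD-Inv ι (ivar x)             = ι x
  subD-Inv ι (iu s)               = iu s
  subD-Inv ι (iabs s₁ s₂ a b m)   =
    iabs s₁ s₂ (subD-Inv ι a) (subD-Inv (extsD-Inv ι) b) (subD-Inv (extsD-Inv ι) m)
  subD-Inv ι (iβ m n)             = iβ (subD-Inv (extsD-Inv ι) m) (subD-Inv ι n)
  subD-Inv ι (iProd s₁ s₂ a b)    = iProd s₁ s₂ (subD-Inv ι a) (subD-Inv (extsD-Inv ι) b)
  subD-Inv ι (iapp s₁ s₂ a b m n) =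
    iapp s₁ s₂ (subD-Inv ι a) (subD-Inv (extsD-Inv ι) b) (subD-Inv ι m) (subD-Inv ι n)

  ⌊extsD-Inv⌋ : ∀ {m n} {σ : Fin m → DTerm n} (ι : ∀ x → Inv (σ x)) {τ : Fin m → ETerm n} →
                (λ x → ⌊ ι x ⌋) ≗ τ → (λ x → ⌊ extsD-Inv ι x ⌋) ≗ extsE τ
  ⌊extsD-Inv⌋ ι h zero    = refl
  ⌊extsD-Inv⌋ ι h (suc x) = trans (⌊renD-Inv⌋ suc (ι x)) (cong (renE suc) (h x))

  ⌊subD-Inv⌋ : ∀ {m n} {σ : Fin m → DTerm n} (ι : ∀ x → Inv (σ x)) {τ : Fin m → ETerm n} →
               (λ x → ⌊ ι x ⌋) ≗ τ → {M : DTerm m} (p : Inv M) → ⌊ subD-Inv ι p ⌋ ≡ subE τ ⌊ p ⌋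
  ⌊subD-Inv⌋ ι h (ivar x)             = h x
  ⌊subD-Inv⌋ ι h (iu s)               = refl
  ⌊subD-Inv⌋ ι h (iabs s₁ s₂ a b m)   =
    cong₃ (lamₑ s₁ s₂) (⌊subD-Inv⌋ ι h a) (⌊subD-Inv⌋ (extsD-Inv ι) (⌊extsD-Inv⌋ ι h) b)
      (⌊subD-Inv⌋ (extsD-Inv ι) (⌊extsD-Inv⌋ ι h) m)
  ⌊subD-Inv⌋ ι {τ} h (iβ m n)         =
    trans (cong₂ _[_]ᴱ (⌊subD-Inv⌋ (extsD-Inv ι) (⌊extsD-Inv⌋ ι h) m) (⌊subD-Inv⌋ ι h n))
      (sym (subE-[]ᴱ τ ⌊ m ⌋ ⌊ n ⌋))
  ⌊subD-Inv⌋ ι h (iProd s₁ s₂ a b)    =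
    cong₂ (piₑ s₁ s₂) (⌊subD-Inv⌋ ι h a) (⌊subD-Inv⌋ (extsD-Inv ι) (⌊extsD-Inv⌋ ι h) b)
  ⌊subD-Inv⌋ ι h (iapp s₁ s₂ a b m n) =
    cong₄ (appₑ s₁ s₂) (⌊subD-Inv⌋ ι h a) (⌊subD-Inv⌋ (extsD-Inv ι) (⌊extsD-Inv⌋ ι h) b)
      (⌊subD-Inv⌋ ι h m) (⌊subD-Inv⌋ ι h n)

  []-Inv : ∀ {n} {M : DTerm (suc n)} {N : DTerm n} → Inv M → Inv N → Inv (M [ N ])
  []-Inv p q = subD-Inv (λ { zero → q ; (suc x) → ivar x }) p

  ⌊[]-Inv⌋ : ∀ {n} {M : DTerm (suc n)} {N : DTerm n} (p : Inv M) (q : Inv N) →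
             ⌊ []-Inv p q ⌋ ≡ ⌊ p ⌋ [ ⌊ q ⌋ ]ᴱ
  ⌊[]-Inv⌋ p q = ⌊subD-Inv⌋ _ (λ { zero → refl ; (suc x) → refl }) p

  Inv-irrelevant : ∀ {n} {M : DTerm n} (p q : Inv M) → p ≡ q
  Inv-irrelevant (ivar x)             (ivar .x)                  = refl
  Inv-irrelevant (iu s)               (iu .s)                    = refl
  Inv-irrelevant (iabs s₁ s₂ a b m)   (iabs .s₁ .s₂ a' b' m')    =
    cong₃ (iabs s₁ s₂) (Inv-irrelevant a a') (Inv-irrelevant b b') (Inv-irrelevant m m')
  Inv-irrelevant (iβ m n)             (iβ m' n')                 =
    cong₂ iβ (Inv-irrelevant m m') (Inv-irrelevant n n')
  Inv-irrelevant (iProd s₁ s₂ a b)    (iProd .s₁ .s₂ a' b')      =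
    cong₂ (iProd s₁ s₂) (Inv-irrelevant a a') (Inv-irrelevant b b')
  Inv-irrelevant (iapp s₁ s₂ a b m n) (iapp .s₁ .s₂ a' b' m' n') =
    cong₄ (iapp s₁ s₂) (Inv-irrelevant a a') (Inv-irrelevant b b') (Inv-irrelevant m m')
      (Inv-irrelevant n n')

  Reduct : (∀ {n} → ETerm n → ETerm n → Set) → ∀ {n} {M : DTerm n} → Inv M → DTerm n → Set
  Reduct _∼_ p N = Σ (Inv N) (λ r → ⌊ p ⌋ ∼ ⌊ r ⌋)

  Σ⇒∀-Inv : ∀ {n} {N : DTerm n} (P : ETerm n → Set) →
            Σ (Inv N) (P ∘ ⌊_⌋) → Inv N × (∀ (r : Inv N) → P ⌊ r ⌋)
  Σ⇒∀-Inv P (r , pr) = r , λ r' → subst (P ∘ ⌊_⌋) (Inv-irrelevant r r') pr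

  module StepSimulation
    (k : RuleKind) (_∼_ : ∀ {n} → ETerm n → ETerm n → Set)
    (∼-refl : ∀ {n} {M : ETerm n} → M ∼ M)
    (piₑ-∼ : ∀ {n s₁ s₂} {A A' : ETerm n} {B B'} → A ∼ A' → B ∼ B' →
             piₑ s₁ s₂ A B ∼ piₑ s₁ s₂ A' B')
    (lamₑ-∼ : ∀ {n s₁ s₂} {A A' : ETerm n} {B B' M M'} → A ∼ A' → B ∼ B' → M ∼ M' →
              lamₑ s₁ s₂ A B M ∼ lamₑ s₁ s₂ A' B' M')
    (appₑ-∼ : ∀ {n s₁ s₂} {A A' : ETerm n} {B B' M M' N N'} →
              A ∼ A' → B ∼ B' → M ∼ M' → N ∼ N' → appₑ s₁ s₂ A B M N ∼ appₑ s₁ s₂ A' B' M' N')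
    ([]ᴱ-∼ : ∀ {n} {M M' : ETerm (suc n)} {N N' : ETerm n} → M ∼ M' → N ∼ N' →
             (M [ N ]ᴱ) ∼ (M' [ N' ]ᴱ))
    (simulate-top : ∀ {n} {M N : DTerm n} → Top k M N → (p : Inv M) → Reduct _∼_ p N)
    where

    data BinderReduct {n} {B : DTerm (suc n)} (b : Inv B) : DTerm n → Set where
      binder : ∀ {T'} {B'} (r : Inv B') → ⌊ b ⌋ ∼ ⌊ r ⌋ → BinderReduct b (lamd T' B')

    mutual
      simulate : ∀ {n} {M N : DTerm n} (p : Inv M) → Step k M N → Reduct _∼_ p N
      simulate p (top t) = simulate-top t p
      simulate (iabs s₁ s₂ a b m) (·₁ (top ()))
      simulate (iabs s₁ s₂ a b m) (·₁ (·₁ (top ())))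
      simulate (iabs s₁ s₂ a b m) (·₁ (·₁ (·₁ (top ()))))
      simulate (iabs s₁ s₂ a b m) (·₁ (·₁ (·₂ s))) =
        let r , e = simulate a s in iabs s₁ s₂ r b m , lamₑ-∼ e ∼-refl ∼-refl
      simulate (iabs s₁ s₂ a b m) (·₁ (·₂ s)) with simulate-binder b s
      ... | binder r e = iabs s₁ s₂ a r m , lamₑ-∼ ∼-refl e ∼-refl
      simulate (iabs s₁ s₂ a b m) (·₂ s) with simulate-binder m s
      ... | binder r e = iabs s₁ s₂ a b r , lamₑ-∼ ∼-refl ∼-refl e
      simulate (iβ m n) (·₁ s) with simulate-binder m s
      ... | binder r e = iβ r n , []ᴱ-∼ e ∼-refl
      simulate (iβ m n) (·₂ s) = let r , e = simulate n s in iβ m r , []ᴱ-∼ {M = ⌊ m ⌋} ∼-refl e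
      simulate (iProd s₁ s₂ a b) (·₁ (top ()))
      simulate (iProd s₁ s₂ a b) (·₁ (·₁ (top ())))
      simulate (iProd s₁ s₂ a b) (·₁ (·₂ s)) =
        let r , e = simulate a s in iProd s₁ s₂ r b , piₑ-∼ e ∼-refl
      simulate (iProd s₁ s₂ a b) (·₂ s) with simulate-binder b s
      ... | binder r e = iProd s₁ s₂ a r , piₑ-∼ ∼-refl e
      simulate (iapp s₁ s₂ a b m n) (·₁ (top ()))
      simulate (iapp s₁ s₂ a b m n) (·₁ (·₁ (top ())))
      simulate (iapp s₁ s₂ a b m n) (·₁ (·₁ (·₁ (top ()))))
      simulate (iapp s₁ s₂ a b m n) (·₁ (·₁ (·₁ (·₁ (top ())))))
      simulate (iapp s₁ s₂ a b m n) (·₁ (·₁ (·₁ (·₂ s)))) =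
        let r , e = simulate a s in iapp s₁ s₂ r b m n , appₑ-∼ e ∼-refl ∼-refl ∼-refl
      simulate (iapp s₁ s₂ a b m n) (·₁ (·₁ (·₂ s))) with simulate-binder b s
      ... | binder r e = iapp s₁ s₂ a r m n , appₑ-∼ ∼-refl e ∼-refl ∼-refl
      simulate (iapp s₁ s₂ a b m n) (·₁ (·₂ s)) =
        let r , e = simulate m s in iapp s₁ s₂ a b r n , appₑ-∼ ∼-refl ∼-refl e ∼-refl
      simulate (iapp s₁ s₂ a b m n) (·₂ s) =
        let r , e = simulate n s in iapp s₁ s₂ a b m r , appₑ-∼ ∼-refl ∼-refl ∼-refl e

      simulate-binder : ∀ {n} {T : DTerm n} {B : DTerm (suc n)} {L : DTerm n} (b : Inv B) →
                        Step k (lamd T B) L → BinderReduct b L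
      simulate-binder b (top ())
      simulate-binder b (lamd₁ s) = binder b ∼-refl
      simulate-binder b (lamd₂ s) = let r , e = simulate b s in binder r e

  app-abs-simulation : ∀ {n} {M N : DTerm n} → Top appK M N → (p : Inv M) → Reduct _⟶ᴱ*_ p N
  app-abs-simulation (app-abs _) (iapp s₁ s₂ a b (iabs _ _ a' b' m) q) = iβ m q , beta ◅ ε

  β-simulation : ∀ {n} {M N : DTerm n} → Top βK M N → (p : Inv M) → Reduct _≡_ p N
  β-simulation βr (iβ m n) = []-Inv m n , sym (⌊[]-Inv⌋ m n)

  El-u-simulation : ∀ {n} {M N : DTerm n} → Top ElK M N → (p : Inv M) → Reduct _≡_ p N
  El-u-simulation (El-u _) ()

  module AppSimulation = StepSimulation appK _⟶ᴱ*_ ε piₑ-⟶ᴱ* lamₑ-⟶ᴱ* appₑ-⟶ᴱ* []ᴱ-⟶ᴱ*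
    app-abs-simulation
  module βSimulation = StepSimulation βK _≡_ refl (cong₂ (piₑ _ _)) (cong₃ (lamₑ _ _))
    (cong₄ (appₑ _ _)) (cong₂ _[_]ᴱ) β-simulation
  module ElSimulation = StepSimulation ElK _≡_ refl (cong₂ (piₑ _ _)) (cong₃ (lamₑ _ _))
    (cong₄ (appₑ _ _)) (cong₂ _[_]ᴱ) El-u-simulation

  βEl-simulation : ∀ {n} {M N : DTerm n} (p : Inv M) → Step βK M N ⊎ Step ElK M N → Reduct _≡_ p N
  βEl-simulation p (inj₁ s) = βSimulation.simulate p s
  βEl-simulation p (inj₂ s) = ElSimulation.simulate p s

  ⟶-simulation : ∀ {n} {M N : DTerm n} (p : Inv M) → M ⟶ N → Reduct _⟶ᴱ*_ p N
  ⟶-simulation p (step appK s) = AppSimulation.simulate p s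
  ⟶-simulation p (step βK s)   = let r , e = βEl-simulation p (inj₁ s) in r , subst (_ ⟶ᴱ*_) e ε
  ⟶-simulation p (step ElK s)  = let r , e = βEl-simulation p (inj₂ s) in r , subst (_ ⟶ᴱ*_) e ε

  ⟶*-simulation : ∀ {n} {M N : DTerm n} (p : Inv M) → M ⟶* N → Reduct _⟶ᴱ*_ p N
  ⟶*-simulation p ε        = p , ε
  ⟶*-simulation p (s ◅ ss) =
    let r , e = ⟶-simulation p s ; r' , e' = ⟶*-simulation r ss in r' , e ◅◅ e'

mainTheorem13 : (𝒮 : PTSSpec) → let open Syntax 𝒮 in
    (∀ {n} {M : DTerm (suc n)} {N : DTerm n} (p : Inv M) (q : Inv N) →
       Inv (M [ N ]) × (∀ (r : Inv (M [ N ])) → ⌊ p ⌋ [ ⌊ q ⌋ ]ᴱ ≡ ⌊ r ⌋))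
    × (∀ {n} {M N : DTerm n} (p : Inv M) → Step appK M N →
       Inv N × (∀ (r : Inv N) → ⌊ p ⌋ ⟶ᴱ* ⌊ r ⌋))
    × (∀ {n} {M N : DTerm n} (p : Inv M) → Step βK M N ⊎ Step ElK M N →
       Inv N × (∀ (r : Inv N) → ⌊ p ⌋ ≡ ⌊ r ⌋))
    × (∀ {n} {M N : DTerm n} (p : Inv M) → M ⟶* N →
       Inv N × (∀ (r : Inv N) → ⌊ p ⌋ ⟶ᴱ* ⌊ r ⌋))
mainTheorem13 𝒮 =
    (λ p q → Σ⇒∀-Inv (⌊ p ⌋ [ ⌊ q ⌋ ]ᴱ ≡_) ([]-Inv p q , sym (⌊[]-Inv⌋ p q)))
  , (λ p s → Σ⇒∀-Inv (⌊ p ⌋ ⟶ᴱ*_) (AppSimulation.simulate p s))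
  , (λ p s → Σ⇒∀-Inv (⌊ p ⌋ ≡_) (βEl-simulation p s))
  , (λ p s → Σ⇒∀-Inv (⌊ p ⌋ ⟶ᴱ*_) (⟶*-simulation p s))
  where
  open Syntax 𝒮
  open InverseTranslation 𝒮
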